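{- Let $n,s,k$ be integers with $1\le s\le n$ and $k\ge 1$. Then $$p^1_{n;\le s;k}=p^2_{n;\le s;k}=\cdots=p^k_{n;\le s;k}.$$
   Context: Parking model: there are $n$ parking spaces in a line, numbered $1,\dots,n$. A preference set of length $n$ is a sequence $(a_1,\dots,a_n)$ of integers with $1\le a_i\le n$; cars $1,\dots,n$ arrive in order, car $i$ parks in the first unoccupied space numbered $\ge a_i$ if one exists, otherwise it fails to park. It is a $k$-flaw preference set if exactly $k$ cars fail to park. $p^l_{n;\le s;k}$ denotes the number of $k$-flaw preference sets $(a_1,\dots,a_n)$ of length $n$ with $n$ spaces such that $a_i\le s$ for all $i$ and $a_1=l$ (this is $0$ if $l>s$). -}

module Defs where

open import Data.Nat using (ℕ; zero; suc; _+_; _≤ᵇ_; _≡ᵇ_)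
open import Data.Bool using (Bool; true; false; _∧_; if_then_else_)
open import Data.List using (List; []; _∷_; length; replicate; map; concatMap; upTo; filterᵇ)
open import Data.Bool.ListAction using (all)
open import Data.Maybe using (Maybe; just; nothing)
open import Data.Product using (_×_; _,_)

-- Occupancy of spaces 1..n is a list of Bools (true = occupied), space i at position i-1.

-- Park a car with preference a (1-based) in occupancy list whose first
-- entry is space number `pos`.
parkFrom : ℕ → ℕ → List Bool → Maybe (List Bool)
parkFrom pos a [] = nothing
parkFrom pos a (o ∷ os) with (a ≤ᵇ pos) ∧ (if o then false else true)
... | true  = just (true ∷ os)
... | false with parkFrom (suc pos) a os
...   | just os' = just (o ∷ os')
...   | nothing  = nothing

park : ℕ → List Bool → Maybe (List Bool)
park a occ = parkFrom 1 a occ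

failures : List Bool → List ℕ → ℕ
failures occ [] = 0
failures occ (a ∷ as) with park a occ
... | just occ' = failures occ' as
... | nothing   = suc (failures occ as)

flaws : ℕ → List ℕ → ℕ
flaws n as = failures (replicate n false) as

seqs : ℕ → ℕ → List (List ℕ)
seqs n zero    = [] ∷ []
seqs n (suc m) = concatMap (λ a → map (a ∷_) (seqs n m)) (map suc (upTo n))

prefSets : ℕ → List (List ℕ)
prefSets n = seqs n n

firstIs : ℕ → List ℕ → Bool
firstIs l []      = false
firstIs l (a ∷ _) = a ≡ᵇ l

p : ℕ → ℕ → ℕ → ℕ → ℕ
p n s k l = length (filterᵇ (λ as → all (λ a → a ≤ᵇ s) as ∧ firstIs l as ∧ (flaws n as ≡ᵇ k)) (prefSets n))

-- The number of cars that fail to park is the maximum over j of the excess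
-- (#preferences ≥ j) ∸ (#vacant spaces ≥ j).  Once the first car has parked at its
-- preference l on the empty lot, the excess at j is at most j ∸ 1, hence below k for
-- j ≤ k, while for j > k ≥ l it no longer depends on l.  So whether exactly k cars
-- fail is the same for every first preference l ≤ k, and for l ≤ s the sequences
-- counted by p^l and p^1 correspond by changing the first entry.  If l > s then
-- p^l = 0, and p^1 = 0 as well: with all preferences ≤ s < k the excess, hence the
-- number of failures, stays below s.

module Submission where

open import Defs
open import Algebra.Properties.CommutativeSemigroup using (x∙yz≈y∙xz)
open import Data.Bool using (Bool; true; false; _∧_; if_then_else_; T?)
open import Data.Bool.ListAction using (all)
open import Data.Bool.Properties using (∧-zeroʳ)
open import Data.List using (List; []; _∷_; _++_; length; replicate; map; concatMap; applyUpTo; upTo; filterᵇ)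
open import Data.List.Properties using (length-++; filter-++; map-upTo)
open import Data.List.Relation.Unary.All as All using (All; []; _∷_)
open import Data.List.Relation.Unary.All.Properties using (map⁺; concat⁺)
open import Data.Maybe as Maybe using (Maybe; just; nothing)
open import Data.Nat
open import Data.Nat.Properties
open import Data.Product using (∃-syntax; _×_; _,_)
open import Function using (_∘_; _⇔_; mk⇔)
open import Relation.Nullary using (contradiction; yes; no; proof)
open import Relation.Nullary.Decidable using (dec-true; dec-false; does-⇔)
open import Relation.Nullary.Reflects using (Reflects; ofʸ; ofⁿ)
open import Relation.Binary.PropositionalEquality

≡ᵇ-reflects-≡ : ∀ m n → Reflects (m ≡ n) (m ≡ᵇ n)
≡ᵇ-reflects-≡ m n = proof (m ≟ n)

𝟙[_≤_] : ℕ → ℕ → ℕ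
𝟙[ j ≤ q ] = if j ≤ᵇ q then 1 else 0

𝟙-yes : ∀ {j q} → j ≤ q → 𝟙[ j ≤ q ] ≡ 1
𝟙-yes {j} {q} j≤q rewrite dec-true (j ≤? q) j≤q = refl

𝟙-no : ∀ {j q} → q < j → 𝟙[ j ≤ q ] ≡ 0
𝟙-no {j} {q} q<j rewrite dec-false (j ≤? q) (<⇒≱ q<j) = refl

𝟙-≤1 : ∀ j q → 𝟙[ j ≤ q ] ≤ 1
𝟙-≤1 j q with j ≤ᵇ q
... | true  = ≤-refl
... | false = z≤n

𝟙-monoʳ : ∀ j {q r} → q ≤ r → 𝟙[ j ≤ q ] ≤ 𝟙[ j ≤ r ]
𝟙-monoʳ j {q} q≤r with j ≤ᵇ q | ≤ᵇ-reflects-≤ j q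
... | true  | ofʸ j≤q = ≤-reflexive (sym (𝟙-yes (≤-trans j≤q q≤r)))
... | false | _       = z≤n

𝟙-antitoneˡ : ∀ {i j} q → i ≤ j → 𝟙[ j ≤ q ] ≤ 𝟙[ i ≤ q ]
𝟙-antitoneˡ {i} {j} q i≤j with j ≤ᵇ q | ≤ᵇ-reflects-≤ j q
... | true  | ofʸ j≤q = ≤-reflexive (sym (𝟙-yes (≤-trans i≤j j≤q)))
... | false | _       = z≤n

vacant : ℕ → ℕ → List Bool → ℕ
vacant j pos []           = 0
vacant j pos (true  ∷ os) = vacant j (suc pos) os
vacant j pos (false ∷ os) = 𝟙[ j ≤ pos ] + vacant j (suc pos) os

demand : ℕ → List ℕ → ℕ
demand j []       = 0
demand j (a ∷ as) = 𝟙[ j ≤ a ] + demand j as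

vacant-below : ∀ {j pos} os → j ≤ pos → vacant j pos os ≡ vacant 0 pos os
vacant-below []           j≤pos = refl
vacant-below (true  ∷ os) j≤pos = vacant-below os (m≤n⇒m≤1+n j≤pos)
vacant-below (false ∷ os) j≤pos = cong₂ _+_ (𝟙-yes j≤pos) (vacant-below os (m≤n⇒m≤1+n j≤pos))

vacant-replicate : ∀ m pos j → vacant j pos (replicate m false) ≡ m ∸ (j ∸ pos)
vacant-replicate zero    pos j = sym (0∸n≡0 (j ∸ pos))
vacant-replicate (suc m) pos j with j ≤? pos
... | yes j≤pos = begin
  𝟙[ j ≤ pos ] + vacant j (suc pos) (replicate m false)  ≡⟨ cong₂ _+_ (𝟙-yes j≤pos) (vacant-replicate m (suc pos) j) ⟩
  suc (m ∸ (j ∸ suc pos))                                ≡⟨ cong (λ x → suc (m ∸ x)) (m≤n⇒m∸n≡0 (m≤n⇒m≤1+n j≤pos)) ⟩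
  suc m                                                  ≡⟨ cong (suc m ∸_) (sym (m≤n⇒m∸n≡0 j≤pos)) ⟩
  suc m ∸ (j ∸ pos)                                      ∎
  where open ≡-Reasoning
... | no j≰pos = begin
  𝟙[ j ≤ pos ] + vacant j (suc pos) (replicate m false)  ≡⟨ cong₂ _+_ (𝟙-no (≰⇒> j≰pos)) (vacant-replicate m (suc pos) j) ⟩
  suc m ∸ suc (j ∸ suc pos)                              ≡⟨ cong (suc m ∸_) (sym (+-∸-assoc 1 (≰⇒> j≰pos))) ⟩
  suc m ∸ (j ∸ pos)                                      ∎
  where open ≡-Reasoning

demand-antitone : ∀ {i j} as → i ≤ j → demand j as ≤ demand i as
demand-antitone []       i≤j = z≤n
demand-antitone (a ∷ as) i≤j = +-mono-≤ (𝟙-antitoneˡ a i≤j) (demand-antitone as i≤j)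

demand-≤-length : ∀ j as → demand j as ≤ length as
demand-≤-length j []       = z≤n
demand-≤-length j (a ∷ as) = +-mono-≤ (𝟙-≤1 j a) (demand-≤-length j as)

demand-vanishes : ∀ {s j} as → all (_≤ᵇ s) as ≡ true → s < j → demand j as ≡ 0
demand-vanishes []               _   s<j = refl
demand-vanishes {s} {j} (a ∷ as) all≤s s<j with a ≤ᵇ s | ≤ᵇ-reflects-≤ a s
... | true | ofʸ a≤s = cong₂ _+_ (𝟙-no (≤-<-trans a≤s s<j)) (demand-vanishes as all≤s s<j)

-- q is the space taken; the vacancy count is constant on [a, q] because the spaces
-- a, …, q ∸ 1 were occupied.
data ParkOutcome (pos a : ℕ) (os : List Bool) : Maybe (List Bool) → Set where
  full   : (∀ j → a ≤ j → vacant j pos os ≡ 0) → ParkOutcome pos a os nothing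
  parked : ∀ {os'} q → a ≤ q
         → (∀ j → vacant j pos os ≡ 𝟙[ j ≤ q ] + vacant j pos os')
         → (∀ j → a ≤ j → j ≤ q → vacant j pos os' ≡ vacant a pos os')
         → ParkOutcome pos a os (just os')

-- The car drives past space pos: it is occupied, or it lies before the preference a.
outcome-cons : ∀ {pos a os r} o → (o ≡ false → pos < a) →
  ParkOutcome (suc pos) a os r → ParkOutcome pos a (o ∷ os) (Maybe.map (o ∷_) r)
outcome-cons true  _ (full none)                  = full none
outcome-cons true  _ (parked q a≤q split blocked) = parked q a≤q split blocked
outcome-cons {pos} false free⇒pos<a (full none) =
  full λ j a≤j → cong₂ _+_ (𝟙-no (<-≤-trans (free⇒pos<a refl) a≤j)) (none j a≤j)
outcome-cons {pos} false free⇒pos<a (parked q a≤q split blocked) =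
  parked q a≤q
    (λ j → trans (cong (𝟙[ j ≤ pos ] +_) (split j)) (x∙yz≈y∙xz +-commutativeSemigroup 𝟙[ j ≤ pos ] 𝟙[ j ≤ q ] _))
    (λ j a≤j j≤q → cong₂ _+_ (trans (𝟙-no (<-≤-trans (free⇒pos<a refl) a≤j)) (sym (𝟙-no (free⇒pos<a refl))))
                             (blocked j a≤j j≤q))

parkFrom-outcome : ∀ pos a os → ParkOutcome pos a os (parkFrom pos a os)
parkFrom-outcome pos a [] = full λ _ _ → refl
parkFrom-outcome pos a (o ∷ os) with a ≤ᵇ pos | ≤ᵇ-reflects-≤ a pos
parkFrom-outcome pos a (false ∷ os) | true | ofʸ a≤pos =
  parked pos a≤pos (λ _ → refl)
    (λ j a≤j j≤pos → trans (vacant-below os (m≤n⇒m≤1+n j≤pos)) (sym (vacant-below os (m≤n⇒m≤1+n a≤pos))))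
parkFrom-outcome pos a (true ∷ os) | true | _
  with parkFrom (suc pos) a os | parkFrom-outcome (suc pos) a os
... | just _  | outcome = outcome-cons true (λ ()) outcome
... | nothing | outcome = outcome-cons true (λ ()) outcome
parkFrom-outcome pos a (o ∷ os) | false | ofⁿ a≰pos
  with parkFrom (suc pos) a os | parkFrom-outcome (suc pos) a os
... | just _  | outcome = outcome-cons o (λ _ → ≰⇒> a≰pos) outcome
... | nothing | outcome = outcome-cons o (λ _ → ≰⇒> a≰pos) outcome

suc-∸-≤ : ∀ m n → suc m ∸ n ≤ suc (m ∸ n)
suc-∸-≤ m n = m≤n+o⇒m∸n≤o (suc m) n (≤-trans (s≤s (m≤n+m∸n m n)) (≤-reflexive (sym (+-suc n (m ∸ n)))))

excess : List Bool → List ℕ → ℕ → ℕ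
excess os as j = demand j as ∸ vacant j 1 os

record Maximum (f : ℕ → ℕ) (m : ℕ) : Set where
  field
    bounded  : ∀ j → f j ≤ m
    attained : ∃[ j ] m ≤ f j

Maximum-shift : ∀ {f g m} d → (∀ j → f j ≤ d + g j) → (∀ j → ∃[ i ] d + g j ≤ f i) →
  Maximum g m → Maximum f (d + m)
Maximum-shift {f} {g} {m} d f≤g g≤f max-g = record { bounded = bounded ; attained = attained }
  where
  open Maximum max-g renaming (bounded to g≤m; attained to g-attains)
  bounded : ∀ j → f j ≤ d + m
  bounded j = ≤-trans (f≤g j) (+-monoʳ-≤ d (g≤m j))
  attained : ∃[ i ] d + m ≤ f i
  attained with g-attains
  ... | j , m≤gj with g≤f j
  ...   | i , gj≤fi = i , ≤-trans (+-monoʳ-≤ d m≤gj) gj≤fi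

Maximum-above : ∀ {f g m m'} k → Maximum f m → Maximum g m' →
  (∀ j → k < j → f j ≡ g j) → (∀ j → j ≤ k → f j < k) → (∀ j → j ≤ k → g j < k) →
  m ≡ k → m' ≡ k
Maximum-above {f} {g} {m} {m'} k max-f max-g f≡g f<k g<k refl = ≤-antisym m'≤m m≤m'
  where
  open Maximum
  m'≤m : m' ≤ m
  m'≤m with attained max-g
  ... | j , m'≤gj with j ≤? m
  ...   | yes j≤m = ≤-trans m'≤gj (<⇒≤ (g<k j j≤m))
  ...   | no  j≰m = ≤-trans m'≤gj (≤-trans (≤-reflexive (sym (f≡g j (≰⇒> j≰m)))) (bounded max-f j))
  m≤m' : m ≤ m'
  m≤m' with attained max-f
  ... | j , m≤fj with j ≤? m
  ...   | yes j≤m = contradiction m≤fj (<⇒≱ (f<k j j≤m))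
  ...   | no  j≰m = ≤-trans m≤fj (≤-trans (≤-reflexive (f≡g j (≰⇒> j≰m))) (bounded max-g j))

Maximum-parked : ∀ {os os' a m} as → ParkOutcome 1 a os (just os') →
  Maximum (excess os' as) m → Maximum (excess os (a ∷ as)) m
Maximum-parked {os} {os'} {a} as (parked q a≤q split blocked) = Maximum-shift 0 shrinks reached
  where
  open ≤-Reasoning
  unchanged : ∀ i → 𝟙[ i ≤ a ] ≡ 𝟙[ i ≤ q ] → excess os (a ∷ as) i ≡ excess os' as i
  unchanged i same = trans (cong₂ (λ x y → (x + demand i as) ∸ y) same (split i))
                           ([m+n]∸[m+o]≡n∸o 𝟙[ i ≤ q ] (demand i as) (vacant i 1 os'))
  shrinks : ∀ j → excess os (a ∷ as) j ≤ excess os' as j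
  shrinks j = begin
    (𝟙[ j ≤ a ] + demand j as) ∸ vacant j 1 os                   ≡⟨ cong (_ ∸_) (split j) ⟩
    (𝟙[ j ≤ a ] + demand j as) ∸ (𝟙[ j ≤ q ] + vacant j 1 os')   ≤⟨ ∸-monoˡ-≤ (𝟙[ j ≤ q ] + vacant j 1 os')
                                                                             (+-monoˡ-≤ (demand j as) (𝟙-monoʳ j a≤q)) ⟩
    (𝟙[ j ≤ q ] + demand j as) ∸ (𝟙[ j ≤ q ] + vacant j 1 os')   ≡⟨ [m+n]∸[m+o]≡n∸o 𝟙[ j ≤ q ] _ _ ⟩
    excess os' as j                                               ∎
  reached : ∀ j → ∃[ i ] excess os' as j ≤ excess os (a ∷ as) i
  reached j with j ≤? a
  ... | yes j≤a = j , ≤-reflexive (sym (unchanged j (trans (𝟙-yes j≤a) (sym (𝟙-yes (≤-trans j≤a a≤q))))))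
  ... | no  j≰a with j ≤? q
  ...   | no  j≰q = j , ≤-reflexive (sym (unchanged j (trans (𝟙-no (≰⇒> j≰a)) (sym (𝟙-no (≰⇒> j≰q))))))
  ...   | yes j≤q = a , (begin
    demand j as ∸ vacant j 1 os'  ≤⟨ ∸-monoˡ-≤ (vacant j 1 os') (demand-antitone as a≤j) ⟩
    demand a as ∸ vacant j 1 os'  ≡⟨ cong (demand a as ∸_) (blocked j a≤j j≤q) ⟩
    excess os' as a               ≡⟨ sym (unchanged a (trans (𝟙-yes (≤-refl {a})) (sym (𝟙-yes a≤q)))) ⟩
    excess os (a ∷ as) a          ∎)
    where
    a≤j : a ≤ j
    a≤j = <⇒≤ (≰⇒> j≰a)

Maximum-full : ∀ {os a m} as → ParkOutcome 1 a os nothing →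
  Maximum (excess os as) m → Maximum (excess os (a ∷ as)) (suc m)
Maximum-full {os} {a} as (full none) = Maximum-shift 1 grows reached
  where
  open ≤-Reasoning
  at-a : excess os (a ∷ as) a ≡ suc (demand a as)
  at-a rewrite 𝟙-yes (≤-refl {a}) | none a ≤-refl = refl
  grows : ∀ j → excess os (a ∷ as) j ≤ suc (excess os as j)
  grows j = begin
    (𝟙[ j ≤ a ] + demand j as) ∸ vacant j 1 os  ≤⟨ ∸-monoˡ-≤ (vacant j 1 os) (+-monoˡ-≤ (demand j as) (𝟙-≤1 j a)) ⟩
    suc (demand j as) ∸ vacant j 1 os           ≤⟨ suc-∸-≤ (demand j as) (vacant j 1 os) ⟩
    suc (excess os as j)                        ∎
  reached : ∀ j → ∃[ i ] suc (excess os as j) ≤ excess os (a ∷ as) i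
  reached j with a ≤? j
  ... | yes a≤j = a , (begin
    suc (excess os as j)  ≤⟨ s≤s (≤-trans (m∸n≤m (demand j as) (vacant j 1 os)) (demand-antitone as a≤j)) ⟩
    suc (demand a as)     ≡⟨ sym at-a ⟩
    excess os (a ∷ as) a  ∎)
  ... | no  a≰j with vacant j 1 os ≤? demand j as
  ...   | yes v≤d = j , ≤-reflexive (sym (begin-equality
    (𝟙[ j ≤ a ] + demand j as) ∸ vacant j 1 os  ≡⟨ cong (λ x → (x + demand j as) ∸ vacant j 1 os) (𝟙-yes (<⇒≤ (≰⇒> a≰j))) ⟩
    suc (demand j as) ∸ vacant j 1 os           ≡⟨ +-∸-assoc 1 v≤d ⟩
    suc (excess os as j)                        ∎))
  ...   | no  v≰d = a , (begin
    suc (excess os as j)  ≡⟨ cong suc (m≤n⇒m∸n≡0 (<⇒≤ (≰⇒> v≰d))) ⟩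
    1                     ≤⟨ s≤s z≤n ⟩
    suc (demand a as)     ≡⟨ sym at-a ⟩
    excess os (a ∷ as) a  ∎)

failures-maximum : ∀ os as → Maximum (excess os as) (failures os as)
failures-maximum os [] = record
  { bounded  = λ j → ≤-reflexive (0∸n≡0 (vacant j 1 os))
  ; attained = 0 , z≤n
  }
failures-maximum os (a ∷ as) with park a os | parkFrom-outcome 1 a os
... | just os' | outcome = Maximum-parked as outcome (failures-maximum os' as)
... | nothing  | outcome = Maximum-full as outcome (failures-maximum os as)

failures-parked : ∀ {os os' a} as → park a os ≡ just os' → failures os (a ∷ as) ≡ failures os' as
failures-parked as parks rewrite parks = refl

park-empty : ∀ m pos a → pos ≤ a → a < pos + m →
  ∃[ os ] parkFrom pos a (replicate m false) ≡ just os
        × (∀ j → vacant j pos (replicate m false) ≡ 𝟙[ j ≤ a ] + vacant j pos os)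
park-empty zero pos a pos≤a a<pos+0 = contradiction pos≤a (<⇒≱ (subst (a <_) (+-identityʳ pos) a<pos+0))
park-empty (suc m) pos a pos≤a a<pos+m with a ≤ᵇ pos | ≤ᵇ-reflects-≤ a pos
... | true  | ofʸ a≤pos =
  true ∷ replicate m false , refl ,
  λ j → cong (λ x → 𝟙[ j ≤ x ] + vacant j (suc pos) (replicate m false)) (≤-antisym pos≤a a≤pos)
... | false | ofⁿ a≰pos with park-empty m (suc pos) a (≰⇒> a≰pos) (subst (a <_) (+-suc pos m) a<pos+m)
...   | os , parks , split rewrite parks =
  false ∷ os , refl ,
  λ j → trans (cong (𝟙[ j ≤ pos ] +_) (split j)) (x∙yz≈y∙xz +-commutativeSemigroup 𝟙[ j ≤ pos ] 𝟙[ j ≤ a ] _)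

-- The excess once the first car, with preference l, has parked on the empty lot.
record FirstCarProfile (m l : ℕ) (as : List ℕ) : Set where
  field
    profile    : ℕ → ℕ
    maximum    : Maximum profile (flaws (suc m) (l ∷ as))
    beyond     : ∀ j → l < j → profile j ≡ demand j as ∸ vacant j 1 (replicate (suc m) false)
    below-pred : ∀ j → profile j ≤ j ∸ 1

open FirstCarProfile

first-car-profile : ∀ {m l} as → 1 ≤ l → l ≤ suc m → length as ≡ m → FirstCarProfile m l as
first-car-profile {l = l} as 1≤l l≤n refl with park-empty (suc (length as)) 1 l 1≤l (s≤s l≤n)
... | os , parks , split = record
  { profile    = excess os as
  ; maximum    = subst (Maximum (excess os as)) (sym (failures-parked {a = l} as parks)) (failures-maximum os as)
  ; beyond     = λ j l<j → cong (demand j as ∸_) (sym (trans (split j) (cong (_+ vacant j 1 os) (𝟙-no l<j))))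
  ; below-pred = λ j → m≤n+o⇒m∸n≤o (demand j as) (vacant j 1 os) (demand-≤ j)
  }
  where
  open ≤-Reasoning
  n : ℕ
  n = suc (length as)
  demand-≤ : ∀ j → demand j as ≤ vacant j 1 os + (j ∸ 1)
  demand-≤ j = s≤s⁻¹ (begin
    suc (demand j as)                                     ≤⟨ s≤s (demand-≤-length j as) ⟩
    n                                                     ≤⟨ m≤n+m∸n n (j ∸ 1) ⟩
    (j ∸ 1) + (n ∸ (j ∸ 1))                               ≡⟨ +-comm (j ∸ 1) _ ⟩
    (n ∸ (j ∸ 1)) + (j ∸ 1)                               ≡⟨ cong (_+ (j ∸ 1)) (sym (vacant-replicate n 1 j)) ⟩
    vacant j 1 (replicate n false) + (j ∸ 1)              ≡⟨ cong (_+ (j ∸ 1)) (split j) ⟩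
    𝟙[ j ≤ l ] + vacant j 1 os + (j ∸ 1)                  ≤⟨ +-monoˡ-≤ (j ∸ 1) (+-monoˡ-≤ (vacant j 1 os) (𝟙-≤1 j l)) ⟩
    suc (vacant j 1 os + (j ∸ 1))                         ∎)

j∸1<k : ∀ {j k} → 1 ≤ k → j ≤ k → j ∸ 1 < k
j∸1<k 1≤k z≤n       = 1≤k
j∸1<k _   (s≤s j≤k) = s≤s j≤k

flaws-first-car-irrelevant : ∀ {m k l l'} as → length as ≡ m →
  1 ≤ l → l ≤ k → l ≤ suc m → 1 ≤ l' → l' ≤ k → l' ≤ suc m →
  flaws (suc m) (l ∷ as) ≡ k → flaws (suc m) (l' ∷ as) ≡ k
flaws-first-car-irrelevant {m} {k} {l} {l'} as len 1≤l l≤k l≤n 1≤l' l'≤k l'≤n =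
  Maximum-above k (maximum P) (maximum P')
    (λ j k<j → trans (beyond P j (≤-<-trans l≤k k<j)) (sym (beyond P' j (≤-<-trans l'≤k k<j))))
    (λ j j≤k → ≤-<-trans (below-pred P j) (j∸1<k 1≤k j≤k))
    (λ j j≤k → ≤-<-trans (below-pred P' j) (j∸1<k 1≤k j≤k))
  where
  P : FirstCarProfile m l as
  P = first-car-profile as 1≤l l≤n len
  P' : FirstCarProfile m l' as
  P' = first-car-profile as 1≤l' l'≤n len
  1≤k : 1 ≤ k
  1≤k = ≤-trans 1≤l l≤k

flaws-≤-bound : ∀ {m s l} as → length as ≡ m → 1 ≤ l → l ≤ s → l ≤ suc m →
  all (_≤ᵇ s) as ≡ true → flaws (suc m) (l ∷ as) ≤ s ∸ 1
flaws-≤-bound {m} {s} {l} as len 1≤l l≤s l≤n all≤s = bound (first-car-profile as 1≤l l≤n len)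
  where
  bound : FirstCarProfile m l as → flaws (suc m) (l ∷ as) ≤ s ∸ 1
  bound P with Maximum.attained (maximum P)
  ... | j , flaws≤ with j ≤? s
  ...   | yes j≤s = ≤-trans flaws≤ (≤-trans (below-pred P j) (∸-monoˡ-≤ 1 j≤s))
  ...   | no  j≰s = ≤-trans flaws≤ (≤-trans (≤-reflexive vanishes) z≤n)
    where
    vanishes : profile P j ≡ 0
    vanishes = trans (beyond P j (≤-<-trans l≤s (≰⇒> j≰s)))
                     (trans (cong (_∸ vacant j 1 (replicate (suc m) false)) (demand-vanishes as all≤s (≰⇒> j≰s)))
                            (0∸n≡0 (vacant j 1 (replicate (suc m) false))))

countᵇ : {A : Set} → (A → Bool) → List A → ℕ
countᵇ P xs = length (filterᵇ P xs)

countᵇ-++ : ∀ {A : Set} (P : A → Bool) xs ys → countᵇ P (xs ++ ys) ≡ countᵇ P xs + countᵇ P ys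
countᵇ-++ P xs ys = trans (cong length (filter-++ (T? ∘ P) xs ys)) (length-++ (filterᵇ P xs))

countᵇ-map : ∀ {A B : Set} (P : B → Bool) (f : A → B) xs → countᵇ P (map f xs) ≡ countᵇ (P ∘ f) xs
countᵇ-map P f []       = refl
countᵇ-map P f (x ∷ xs) with P (f x)
... | true  = cong suc (countᵇ-map P f xs)
... | false = countᵇ-map P f xs

countᵇ-cong : ∀ {A : Set} {P Q : A → Bool} {xs} → All (λ x → P x ≡ Q x) xs → countᵇ P xs ≡ countᵇ Q xs
countᵇ-cong [] = refl
countᵇ-cong {Q = Q} {x ∷ _} (Px≡Qx ∷ rest) rewrite Px≡Qx with Q x
... | true  = cong suc (countᵇ-cong rest)
... | false = countᵇ-cong rest

countᵇ-none : ∀ {A : Set} {P : A → Bool} {xs} → All (λ x → P x ≡ false) xs → countᵇ P xs ≡ 0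
countᵇ-none [] = refl
countᵇ-none (Px≡false ∷ rest) rewrite Px≡false = countᵇ-none rest

countᵇ-upTo : ∀ {i n} → i < n → countᵇ (_≡ᵇ i) (upTo n) ≡ 1
countᵇ-upTo {i} {suc n} i<n = begin
  countᵇ (_≡ᵇ i) (0 ∷ applyUpTo suc n)    ≡⟨ cong (countᵇ (_≡ᵇ i) ∘ (0 ∷_)) (sym (map-upTo suc n)) ⟩
  countᵇ (_≡ᵇ i) (0 ∷ map suc (upTo n))   ≡⟨ shifted i i<n ⟩
  1                                       ∎
  where
  open ≡-Reasoning
  shifted : ∀ i → i < suc n → countᵇ (_≡ᵇ i) (0 ∷ map suc (upTo n)) ≡ 1
  shifted zero     _         = cong suc (trans (countᵇ-map (_≡ᵇ 0) suc (upTo n))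
                                               (countᵇ-none (All.universal (λ _ → refl) (upTo n))))
  shifted (suc i) (s≤s i<n) = trans (countᵇ-map (_≡ᵇ suc i) suc (upTo n)) (countᵇ-upTo i<n)

countᵇ-blocks : ∀ (P : List ℕ → Bool) l → (∀ a as → a ≢ l → P (a ∷ as) ≡ false) → ∀ S L →
  countᵇ P (concatMap (λ a → map (a ∷_) S) L) ≡ countᵇ (_≡ᵇ l) L * countᵇ (P ∘ (l ∷_)) S
countᵇ-blocks P l other S []      = refl
countᵇ-blocks P l other S (a ∷ L) = begin
  countᵇ P (map (a ∷_) S ++ rest)
    ≡⟨ countᵇ-++ P (map (a ∷_) S) rest ⟩
  countᵇ P (map (a ∷_) S) + countᵇ P rest
    ≡⟨ cong₂ _+_ (countᵇ-map P (a ∷_) S) (countᵇ-blocks P l other S L) ⟩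
  countᵇ (P ∘ (a ∷_)) S + countᵇ (_≡ᵇ l) L * countᵇ (P ∘ (l ∷_)) S
    ≡⟨ head-block ⟩
  countᵇ (_≡ᵇ l) (a ∷ L) * countᵇ (P ∘ (l ∷_)) S
    ∎
  where
  open ≡-Reasoning
  rest : List (List ℕ)
  rest = concatMap (λ a → map (a ∷_) S) L
  head-block : countᵇ (P ∘ (a ∷_)) S + countᵇ (_≡ᵇ l) L * countᵇ (P ∘ (l ∷_)) S
             ≡ countᵇ (_≡ᵇ l) (a ∷ L) * countᵇ (P ∘ (l ∷_)) S
  head-block with a ≡ᵇ l | ≡ᵇ-reflects-≡ a l
  ... | true  | ofʸ refl = refl
  ... | false | ofⁿ a≢l  = cong (_+ _) (countᵇ-none (All.universal (λ as → other a as a≢l) S))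

seqs-length : ∀ n m → All (λ as → length as ≡ m) (seqs n m)
seqs-length n zero    = refl ∷ []
seqs-length n (suc m) =
  concat⁺ (map⁺ (All.universal (λ a → map⁺ (All.map (cong suc) (seqs-length n m))) (map suc (upTo n))))

isCounted : ℕ → ℕ → ℕ → ℕ → List ℕ → Bool
isCounted n s k l as = all (_≤ᵇ s) as ∧ firstIs l as ∧ (flaws n as ≡ᵇ k)

p-first-entry : ∀ m s k l → p (suc m) s k l
  ≡ countᵇ (_≡ᵇ l) (map suc (upTo (suc m))) * countᵇ (isCounted (suc m) s k l ∘ (l ∷_)) (seqs (suc m) m)
p-first-entry m s k l = countᵇ-blocks (isCounted (suc m) s k l) l other (seqs (suc m) m) (map suc (upTo (suc m)))
  where
  other : ∀ a as → a ≢ l → isCounted (suc m) s k l (a ∷ as) ≡ false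
  other a as a≢l rewrite dec-false (a ≟ l) a≢l = ∧-zeroʳ _

countᵇ-first-entries : ∀ {l n} → 1 ≤ l → l ≤ n → countᵇ (_≡ᵇ l) (map suc (upTo n)) ≡ 1
countᵇ-first-entries {suc l} {n} _ l<n = trans (countᵇ-map (_≡ᵇ suc l) suc (upTo n)) (countᵇ-upTo l<n)

isCounted-head : ∀ n s k {l} as → l ≤ s → isCounted n s k l (l ∷ as) ≡ all (_≤ᵇ s) as ∧ (flaws n (l ∷ as) ≡ᵇ k)
isCounted-head n s k {l} as l≤s rewrite dec-true (l ≤? s) l≤s | dec-true (l ≟ l) refl = refl

isCounted-first-entry-irrelevant : ∀ {m s k l} as → length as ≡ m → 1 ≤ s → s ≤ suc m →
  1 ≤ l → l ≤ k → l ≤ s → isCounted (suc m) s k l (l ∷ as) ≡ isCounted (suc m) s k 1 (1 ∷ as)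
isCounted-first-entry-irrelevant {m} {s} {k} {l} as len 1≤s s≤n 1≤l l≤k l≤s = begin
  isCounted n s k l (l ∷ as)                      ≡⟨ isCounted-head n s k as l≤s ⟩
  all (_≤ᵇ s) as ∧ (flaws n (l ∷ as) ≡ᵇ k)        ≡⟨ cong (all (_≤ᵇ s) as ∧_) (does-⇔ same-flaws (_ ≟ k) (_ ≟ k)) ⟩
  all (_≤ᵇ s) as ∧ (flaws n (1 ∷ as) ≡ᵇ k)        ≡⟨ sym (isCounted-head n s k as 1≤s) ⟩
  isCounted n s k 1 (1 ∷ as)                      ∎
  where
  open ≡-Reasoning
  n : ℕ
  n = suc m
  1≤k : 1 ≤ k
  1≤k = ≤-trans 1≤l l≤k
  l≤n : l ≤ n
  l≤n = ≤-trans l≤s s≤n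
  same-flaws : flaws n (l ∷ as) ≡ k ⇔ flaws n (1 ∷ as) ≡ k
  same-flaws = mk⇔ (flaws-first-car-irrelevant as len 1≤l l≤k l≤n ≤-refl 1≤k (s≤s z≤n))
                   (flaws-first-car-irrelevant as len ≤-refl 1≤k (s≤s z≤n) 1≤l l≤k l≤n)

p-no-tails : ∀ m s k l → All (λ as → isCounted (suc m) s k l (l ∷ as) ≡ false) (seqs (suc m) m) →
  p (suc m) s k l ≡ 0
p-no-tails m s k l none = begin
  p (suc m) s k l                                                      ≡⟨ p-first-entry m s k l ⟩
  firsts * countᵇ (isCounted (suc m) s k l ∘ (l ∷_)) (seqs (suc m) m)  ≡⟨ cong (firsts *_) (countᵇ-none none) ⟩
  firsts * 0                                                           ≡⟨ *-zeroʳ firsts ⟩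
  0                                                                    ∎
  where
  open ≡-Reasoning
  firsts : ℕ
  firsts = countᵇ (_≡ᵇ l) (map suc (upTo (suc m)))

p-first-entry-unbounded : ∀ m s k l → s < l → p (suc m) s k l ≡ 0
p-first-entry-unbounded m s k l s<l = p-no-tails m s k l (All.universal excluded (seqs (suc m) m))
  where
  excluded : ∀ as → isCounted (suc m) s k l (l ∷ as) ≡ false
  excluded as rewrite dec-false (l ≤? s) (<⇒≱ s<l) = refl

p-too-many-flaws : ∀ m s k → 1 ≤ s → s ≤ suc m → s < k → p (suc m) s k 1 ≡ 0
p-too-many-flaws m s k 1≤s s≤n s<k =
  p-no-tails m s k 1 (All.map (λ {as} → excluded {as}) (seqs-length (suc m) m))
  where
  excluded : ∀ {as} → length as ≡ m → isCounted (suc m) s k 1 (1 ∷ as) ≡ false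
  excluded {as} len rewrite isCounted-head (suc m) s k as 1≤s with all (_≤ᵇ s) as in all≤s
  ... | false = refl
  ... | true  = dec-false (flaws (suc m) (1 ∷ as) ≟ k)
                  (λ flaws≡k → <⇒≱ s<k (≤-trans (≤-reflexive (sym flaws≡k))
                                (≤-trans (flaws-≤-bound as len ≤-refl 1≤s (s≤s z≤n) all≤s) (m∸n≤m s 1))))

theorem6p1 : (n s k : ℕ) → 1 ≤ s → s ≤ n → 1 ≤ k →
    (l : ℕ) → 1 ≤ l → l ≤ k → p n s k l ≡ p n s k 1
theorem6p1 zero    s k 1≤s s≤0 _ = contradiction (≤-trans 1≤s s≤0) λ ()
theorem6p1 (suc m) s k 1≤s s≤n _ l 1≤l l≤k with l ≤? s
... | yes l≤s = begin
  p n s k l                                                        ≡⟨ p-first-entry m s k l ⟩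
  countᵇ (_≡ᵇ l) firsts * countᵇ (isCounted n s k l ∘ (l ∷_)) tails ≡⟨ cong₂ _*_ same-count same-tails ⟩
  countᵇ (_≡ᵇ 1) firsts * countᵇ (isCounted n s k 1 ∘ (1 ∷_)) tails ≡⟨ sym (p-first-entry m s k 1) ⟩
  p n s k 1                                                        ∎
  where
  open ≡-Reasoning
  n : ℕ
  n = suc m
  firsts : List ℕ
  firsts = map suc (upTo n)
  tails : List (List ℕ)
  tails = seqs n m
  same-count : countᵇ (_≡ᵇ l) firsts ≡ countᵇ (_≡ᵇ 1) firsts
  same-count = trans (countᵇ-first-entries 1≤l (≤-trans l≤s s≤n))
                     (sym (countᵇ-first-entries {1} {n} ≤-refl (s≤s z≤n)))
  same-tails : countᵇ (isCounted n s k l ∘ (l ∷_)) tails ≡ countᵇ (isCounted n s k 1 ∘ (1 ∷_)) tails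
  same-tails = countᵇ-cong (All.map (λ {as} len → isCounted-first-entry-irrelevant as len 1≤s s≤n 1≤l l≤k l≤s)
                                    (seqs-length n m))
... | no  l≰s = trans (p-first-entry-unbounded m s k l (≰⇒> l≰s))
                      (sym (p-too-many-flaws m s k 1≤s s≤n (<-≤-trans (≰⇒> l≰s) l≤k)))
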